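{- Let $m,n\in\mathbb Z^2$ satisfy $Q(m)=Q(n)$. Then for all sufficiently large primes $N$ there exists $B\in SO(Q,\mathbb Z/N\mathbb Z)$ with $m\equiv nB\bmod N$.
   Context: $A=\begin{pmatrix}a&b\\c&d\end{pmatrix}\in SL(2,\mathbb Z)$ is hyperbolic ($|a+d|>2$) and $Q(x,y)=cx^2+(d-a)xy-by^2$. Vectors are row vectors, matrices act on the right. $SO(Q,\mathbb Z/N\mathbb Z)$ is the group of $2\times2$ matrices $B$ over $\mathbb Z/N\mathbb Z$ with $\det B=1$ and $Q(xB)=Q(x)$ for all $x\in(\mathbb Z/N\mathbb Z)^2$. -}

module Defs where

open import Data.Nat using (ℕ) renaming (_<_ to _<ℕ_)
open import Relation.Binary.PropositionalEquality using () renaming (_≡_ to _≡ᵉ_)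
open import Data.Integer using (ℤ; +_; _+_; _-_; _*_; -_; ∣_∣)
open import Data.Integer.Divisibility using (_∣_)
open import Data.Product using (_×_; _,_)

record Mat : Set where
  constructor mat
  field
    m11 m12 m21 m22 : ℤ

Vec2 : Set
Vec2 = ℤ × ℤ

det : Mat → ℤ
det (mat a b c d) = a * d - b * c

trace : Mat → ℤ
trace (mat a b c d) = a + d

-- row vector times matrix (matrices act on the right)
_·_ : Vec2 → Mat → Vec2
(x , y) · mat a b c d = (x * a + y * c , x * b + y * d)

Q : Mat → Vec2 → ℤ
Q (mat a b c d) (x , y) = c * x * x + (d - a) * x * y - b * y * y

_≡_[mod_] : ℤ → ℤ → ℕ → Set
x ≡ y [mod N ] = (+ N) ∣ (x - y)

_≡v_[mod_] : Vec2 → Vec2 → ℕ → Set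
(x₁ , x₂) ≡v (y₁ , y₂) [mod N ] = (x₁ ≡ y₁ [mod N ]) × (x₂ ≡ y₂ [mod N ])

IsHyperbolicSL2 : Mat → Set
IsHyperbolicSL2 A = (det A ≡ᵉ + 1) × (2 <ℕ ∣ trace A ∣)

-- B (integer lift of a matrix over ℤ/Nℤ) lies in SO(Q, ℤ/Nℤ):
-- det B = 1 mod N and Q(xB) = Q(x) mod N for all x ∈ (ℤ/Nℤ)²
-- (quantifying over integer lifts x ∈ ℤ² is equivalent, as Q(xB) mod N
-- depends only on x mod N).
InSO : Mat → ℕ → Mat → Set
InSO A N B = (det B ≡ + 1 [mod N ]) × (∀ (x : Vec2) → Q A (x · B) ≡ Q A x [mod N ])

{-# OPTIONS --safe #-}
module Submission where

-- Q is anisotropic over ℚ: 4c·Q(x,y) = (2cx + (d-a)y)² - ((a+d)² - 4)y², c ≠ 0, and (a+d)² - 4 is not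
-- a rational square when |a+d| ≥ 3. So if Q(n) = 0 then m = n = 0 and B = I. Otherwise the matrices
-- M = αI + βAᵀ satisfy Q(xM) = det M · Q(x), and α, β can be chosen with nM = Q(n)·m and
-- det M = Q(n)Q(m) = Q(n)². For a prime N > |Q(n)| let u be an inverse of Q(n) mod N; then B = uM
-- has det B ≡ 1, preserves Q mod N and sends n to m mod N.

open import Defs
open import Data.Nat using (ℕ; _≥_)
open import Data.Nat.Primality using (Prime)
open import Data.Product using (Σ; ∃; _×_; _,_; proj₁; proj₂)
open import Relation.Binary.PropositionalEquality using (_≡_)

module Squares where
  open import Data.Nat
  open import Data.Nat.Properties
  open import Data.Nat.Divisibility
  open import Data.Nat.DivMod using (_/_; m/n*n≡m)
  open import Data.Nat.GCD using (gcd; gcd[m,n]∣m; gcd[m,n]∣n; gcd[m,n]≢0)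
  open import Data.Nat.Coprimality as Coprime using (coprime-/gcd; coprime-divisor)
  open import Data.Nat.Tactic.RingSolver using (solve-∀)
  open import Data.Sum using (inj₁; inj₂)
  open import Relation.Nullary.Decidable using (yes; no; from-no)
  open import Relation.Binary.PropositionalEquality

  m²+4≢n² : ∀ m {n} → 3 ≤ n → m * m + 4 ≢ n * n
  m²+4≢n² 0 3≤n eq = from-no (9 ≤? 4) (subst (9 ≤_) (sym eq) (*-mono-≤ 3≤n 3≤n))
  m²+4≢n² 1 3≤n eq = from-no (9 ≤? 5) (subst (9 ≤_) (sym eq) (*-mono-≤ 3≤n 3≤n))
  m²+4≢n² m@(suc (suc k)) {n} _ eq with n ≤? m
  ... | yes n≤m = <⇒≱ (subst (m * m <_) eq (m<m+n (m * m) z<s)) (*-mono-≤ n≤m n≤m)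
  ... | no n≰m = <⇒≱ (subst (_< (1 + m) * (1 + m)) eq m²+4<[1+m]²) (*-mono-≤ m<n m<n)
    where
    m<n : m < n
    m<n = ≰⇒> n≰m
    m²+4<[1+m]² : m * m + 4 < (1 + m) * (1 + m)
    m²+4<[1+m]² = subst (m * m + 4 <_) (expand k) (m<m+n (m * m + 4) z<s)
      where
      expand : ∀ k → (2 + k) * (2 + k) + 4 + suc (2 * k) ≡ (3 + k) * (3 + k)
      expand = solve-∀

  m²∣n²⇒m∣n : ∀ m n → m * m ∣ n * n → m ∣ n
  m²∣n²⇒m∣n zero n 0∣n² with m*n≡0⇒m≡0∨n≡0 n (0∣⇒≡0 0∣n²)
  ... | inj₁ refl = ∣-refl
  ... | inj₂ refl = ∣-refl
  m²∣n²⇒m∣n m@(suc _) n m²∣n² = subst₂ _∣_ m′g≡m n′g≡n (*-monoˡ-∣ g m′∣n′)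
    where
    g = gcd n m
    instance
      g≢0 : NonZero g
      g≢0 = ≢-nonZero (gcd[m,n]≢0 n m (inj₂ λ ()))
    m′ = m / g
    n′ = n / g
    m′g≡m : m′ * g ≡ m
    m′g≡m = m/n*n≡m (gcd[m,n]∣n n m)
    n′g≡n : n′ * g ≡ n
    n′g≡n = m/n*n≡m (gcd[m,n]∣m n m)
    m′²∣n′² : m′ * m′ ∣ n′ * n′
    m′²∣n′² = *-cancelʳ-∣ (g * g) {{m*n≢0 g g}} (subst₂ _∣_ (regroup m′) (regroup n′)
      (subst₂ (λ x y → x * x ∣ y * y) (sym m′g≡m) (sym n′g≡n) m²∣n²))
      where
      regroup : ∀ x → x * g * (x * g) ≡ x * x * (g * g)
      regroup x = [m*n]*[o*p]≡[m*o]*[n*p] x g x g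
    m′∣n′ : m′ ∣ n′
    m′∣n′ = coprime-divisor (Coprime.sym (coprime-/gcd n m)) (∣-trans (m∣m*n m′) m′²∣n′²)

  m²+4k²≢n²k² : ∀ m k {n} → k ≢ 0 → 3 ≤ n → m * m + 4 * (k * k) ≢ n * n * (k * k)
  m²+4k²≢n²k² m k {n} k≢0 3≤n eq = m²+4≢n² q 3≤n (*-cancelʳ-≡ (q * q + 4) (n * n) (k * k) {{k²≢0}} (begin
    (q * q + 4) * (k * k)          ≡⟨ regroup q k ⟩
    q * k * (q * k) + 4 * (k * k)  ≡⟨ cong (λ x → x * x + 4 * (k * k)) m≡qk ⟨
    m * m + 4 * (k * k)            ≡⟨ eq ⟩
    n * n * (k * k)                ∎))
    where
    open ≡-Reasoning
    k²≢0 : NonZero (k * k)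
    k²≢0 = m*n≢0 k k {{≢-nonZero k≢0}} {{≢-nonZero k≢0}}
    k²∣m² : k * k ∣ m * m
    k²∣m² = ∣m+n∣m⇒∣n (subst (k * k ∣_) (trans (sym eq) (+-comm (m * m) _)) (n∣m*n (n * n))) (n∣m*n 4)
    q = quotient (m²∣n²⇒m∣n k m k²∣m²)
    m≡qk : m ≡ q * k
    m≡qk = m∣n⇒n≡quotient*m (m²∣n²⇒m∣n k m k²∣m²)
    regroup : ∀ q k → (q * q + 4) * (k * k) ≡ q * k * (q * k) + 4 * (k * k)
    regroup = solve-∀

open import Data.Empty using (⊥-elim)
open import Data.Sum using (inj₁; inj₂; [_,_]′)
open import Function using (id; _∘_)
import Data.Nat as ℕ
import Data.Nat.Properties as ℕ
open import Data.Nat.Divisibility using () renaming (_∣_ to _∣ℕ_)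
open import Data.Nat.GCD using (module Bézout)
open import Data.Nat.Coprimality using (coprime-Bézout; prime⇒coprime)
open import Data.Integer using (ℤ; +_; -[1+_]; 0ℤ; 1ℤ; _+_; _-_; _*_; -_; ∣_∣; _≟_)
open import Data.Integer.Divisibility using (_∣_)
open import Data.Integer.Properties
  using (pos-+; pos-*; +-injective; abs-*; ∣i+j∣≤∣i∣+∣j∣; ∣i∣≡0⇒i≡0; ∣i-j∣≡∣j-i∣; +∣i∣≡i⊎+∣i∣≡-i;
         +-minus-telescope; +-inverseʳ; +-identityʳ; *-zeroʳ; i*j≡0⇒i≡0∨j≡0; neg-distribˡ-*; neg-distribʳ-*)
import Data.Integer.Divisibility.Signed as Signed
open import Data.Integer.Tactic.RingSolver using (solve-∀)
open import Relation.Nullary.Decidable using (yes; no)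
open import Relation.Binary.PropositionalEquality
  using (_≢_; refl; sym; trans; cong; cong₂; subst; module ≡-Reasoning)

open Squares using (m²+4k²≢n²k²)

i*i≡+∣i∣*∣i∣ : ∀ i → i * i ≡ + (∣ i ∣ ℕ.* ∣ i ∣)
i*i≡+∣i∣*∣i∣ (+ n)    = sym (pos-* n n)
i*i≡+∣i∣*∣i∣ -[1+ n ] = refl

i²+4k²≢j²k² : ∀ i j k → k ≢ 0ℤ → 3 ℕ.≤ ∣ j ∣ → i * i + + 4 * (k * k) ≢ j * j * (k * k)
i²+4k²≢j²k² i j k k≢0 3≤∣j∣ eq = m²+4k²≢n²k² ∣ i ∣ ∣ k ∣ (k≢0 ∘ ∣i∣≡0⇒i≡0) 3≤∣j∣ (+-injective (begin
  + (∣i∣² ℕ.+ 4 ℕ.* ∣k∣²)   ≡⟨ pos-+ ∣i∣² (4 ℕ.* ∣k∣²) ⟩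
  + ∣i∣² + + (4 ℕ.* ∣k∣²)    ≡⟨ cong₂ _+_ (refl {x = + ∣i∣²}) (pos-* 4 ∣k∣²) ⟩
  + ∣i∣² + + 4 * + ∣k∣²      ≡⟨ cong₂ (λ x y → x + + 4 * y) (i*i≡+∣i∣*∣i∣ i) (i*i≡+∣i∣*∣i∣ k) ⟨
  i * i + + 4 * (k * k)     ≡⟨ eq ⟩
  j * j * (k * k)           ≡⟨ cong₂ _*_ (i*i≡+∣i∣*∣i∣ j) (i*i≡+∣i∣*∣i∣ k) ⟩
  + ∣j∣² * + ∣k∣²            ≡⟨ pos-* ∣j∣² ∣k∣² ⟨
  + (∣j∣² ℕ.* ∣k∣²)          ∎))
  where
  open ≡-Reasoning
  ∣i∣² = ∣ i ∣ ℕ.* ∣ i ∣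
  ∣j∣² = ∣ j ∣ ℕ.* ∣ j ∣
  ∣k∣² = ∣ k ∣ ℕ.* ∣ k ∣

hyperbolic⇒c≢0 : ∀ {a b c d} → IsHyperbolicSL2 (mat a b c d) → c ≢ 0ℤ
hyperbolic⇒c≢0 {a} {b} {d = d} (det≡1 , 2<∣a+d∣) refl =
  ℕ.<⇒≱ 2<∣a+d∣ (ℕ.≤-trans (∣i+j∣≤∣i∣+∣j∣ a d) (ℕ.≤-reflexive (cong₂ ℕ._+_ ∣a∣≡1 ∣d∣≡1)))
  where
  det-triangular : ∀ a b d → a * d - b * 0ℤ ≡ a * d
  det-triangular = solve-∀
  ∣a∣∣d∣≡1 : ∣ a ∣ ℕ.* ∣ d ∣ ≡ 1
  ∣a∣∣d∣≡1 = trans (sym (abs-* a d)) (cong ∣_∣ (trans (sym (det-triangular a b d)) det≡1))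
  ∣a∣≡1 = ℕ.m*n≡1⇒m≡1 ∣ a ∣ ∣ d ∣ ∣a∣∣d∣≡1
  ∣d∣≡1 = ℕ.m*n≡1⇒n≡1 ∣ a ∣ ∣ d ∣ ∣a∣∣d∣≡1

completing-square : ∀ a b c d x y →
  (+ 2 * c * x + (d - a) * y) * (+ 2 * c * x + (d - a) * y) + + 4 * (a * d - b * c) * (y * y)
    ≡ (a + d) * (a + d) * (y * y) + + 4 * c * (c * x * x + (d - a) * x * y - b * y * y)
completing-square = solve-∀

Q-anisotropic : ∀ {A} → IsHyperbolicSL2 A → ∀ x → Q A x ≡ 0ℤ → x ≡ (0ℤ , 0ℤ)
Q-anisotropic {mat a b c d} hyp (x , y) Q≡0 with y ≟ 0ℤ
... | yes refl = cong (_, 0ℤ) x≡0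
  where
  Q-on-axis : ∀ a b c d x → c * x * x + (d - a) * x * 0ℤ - b * 0ℤ * 0ℤ ≡ c * (x * x)
  Q-on-axis = solve-∀
  x≡0 : x ≡ 0ℤ
  x≡0 with i*j≡0⇒i≡0∨j≡0 c (trans (sym (Q-on-axis a b c d x)) Q≡0)
  ... | inj₁ c≡0  = ⊥-elim (hyperbolic⇒c≢0 {a} {b} {c} {d} hyp c≡0)
  ... | inj₂ x²≡0 = [ id , id ]′ (i*j≡0⇒i≡0∨j≡0 x x²≡0)
... | no y≢0 = ⊥-elim (i²+4k²≢j²k² s (a + d) y y≢0 (proj₂ hyp) (begin
  s * s + + 4 * (y * y)                   ≡⟨ cong (λ δ → s * s + + 4 * δ * (y * y)) (proj₁ hyp) ⟨
  s * s + + 4 * (a * d - b * c) * (y * y) ≡⟨ completing-square a b c d x y ⟩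
  t²y² + + 4 * c * Q A (x , y)            ≡⟨ cong (λ q → t²y² + + 4 * c * q) Q≡0 ⟩
  t²y² + + 4 * c * 0ℤ                     ≡⟨ cong₂ _+_ (refl {x = t²y²}) (*-zeroʳ (+ 4 * c)) ⟩
  t²y² + 0ℤ                               ≡⟨ +-identityʳ t²y² ⟩
  t²y²                                    ∎))
  where
  open ≡-Reasoning
  A = mat a b c d
  s = + 2 * c * x + (d - a) * y
  t²y² = (a + d) * (a + d) * (y * y)

module _ {N : ℕ} where

  private
    fromSigned : ∀ {z} → + N Signed.∣ z → + N ∣ z
    fromSigned = Signed.∣⇒∣ᵤ

    toSigned : ∀ {z} → + N ∣ z → + N Signed.∣ z
    toSigned = Signed.∣ᵤ⇒∣

  ≡⇒≡[mod] : ∀ {x y} → x ≡ y → x ≡ y [mod N ]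
  ≡⇒≡[mod] {x} refl = fromSigned (Signed.divides 0ℤ (+-inverseʳ x))

  ≡[mod]-sym : ∀ x y → x ≡ y [mod N ] → y ≡ x [mod N ]
  ≡[mod]-sym x y = subst (N ∣ℕ_) (∣i-j∣≡∣j-i∣ x y)

  ≡[mod]-trans : ∀ x y z → x ≡ y [mod N ] → y ≡ z [mod N ] → x ≡ z [mod N ]
  ≡[mod]-trans x y z x≡y y≡z = fromSigned (subst ((+ N) Signed.∣_) (+-minus-telescope x y z)
    (Signed.∣m∣n⇒∣m+n (toSigned {x - y} x≡y) (toSigned {y - z} y≡z)))

  ≡1[mod]⇒*-identityˡ : ∀ x y → x ≡ 1ℤ [mod N ] → (x * y) ≡ y [mod N ]
  ≡1[mod]⇒*-identityˡ x y x≡1 =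
    fromSigned (subst ((+ N) Signed.∣_) (factor x y) (Signed.∣m⇒∣m*n y (toSigned {x - 1ℤ} x≡1)))
    where
    factor : ∀ x y → (x - 1ℤ) * y ≡ x * y - y
    factor = solve-∀

  ≡⇒≡v[mod] : ∀ {x y} → x ≡ y → x ≡v y [mod N ]
  ≡⇒≡v[mod] {x₁ , x₂} refl = ≡⇒≡[mod] {x₁} refl , ≡⇒≡[mod] {x₂} refl

pos-1+m*n≡o*q : ∀ m n o q → 1 ℕ.+ m ℕ.* n ≡ o ℕ.* q → 1ℤ + + m * + n ≡ + o * + q
pos-1+m*n≡o*q m n o q eq = begin
  1ℤ + + m * + n     ≡⟨ cong₂ _+_ (refl {x = 1ℤ}) (pos-* m n) ⟨
  1ℤ + + (m ℕ.* n)   ≡⟨ pos-+ 1 (m ℕ.* n) ⟨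
  + (1 ℕ.+ m ℕ.* n)  ≡⟨ cong +_ eq ⟩
  + (o ℕ.* q)        ≡⟨ pos-* o q ⟩
  + o * + q          ∎
  where open ≡-Reasoning

inverse-mod-prime⁺ : ∀ {p k} → Prime p → .{{ℕ.NonZero k}} → k ℕ.< p → ∃ λ u → (u * + k) ≡ 1ℤ [mod p ]
inverse-mod-prime⁺ {p} {k} p-prime k<p with coprime-Bézout (prime⇒coprime p-prime k<p)
... | Bézout.+- x y 1+yk≡xp = - + y , Signed.∣⇒∣ᵤ (Signed.divides (- + x) (begin
  (- + y) * + k - 1ℤ  ≡⟨ negate (+ y) (+ k) ⟩
  - (1ℤ + + y * + k)  ≡⟨ cong -_ (pos-1+m*n≡o*q y k x p 1+yk≡xp) ⟩
  - (+ x * + p)       ≡⟨ neg-distribˡ-* (+ x) (+ p) ⟩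
  (- + x) * + p       ∎))
  where
  open ≡-Reasoning
  negate : ∀ y k → (- y) * k - 1ℤ ≡ - (1ℤ + y * k)
  negate = solve-∀
... | Bézout.-+ x y 1+xp≡yk = + y , Signed.∣⇒∣ᵤ (Signed.divides (+ x) (begin
  + y * + k - 1ℤ       ≡⟨ cong (_- 1ℤ) (pos-1+m*n≡o*q x p y k 1+xp≡yk) ⟨
  1ℤ + + x * + p - 1ℤ  ≡⟨ cancel (+ x * + p) ⟩
  + x * + p            ∎))
  where
  open ≡-Reasoning
  cancel : ∀ z → 1ℤ + z - 1ℤ ≡ z
  cancel = solve-∀

inverse-mod-prime : ∀ {p D} → Prime p → D ≢ 0ℤ → ∣ D ∣ ℕ.< p → ∃ λ u → (u * D) ≡ 1ℤ [mod p ]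
inverse-mod-prime {p} {D} p-prime D≢0 ∣D∣<p
  with inverse-mod-prime⁺ p-prime {{∣D∣≢0}} ∣D∣<p | +∣i∣≡i⊎+∣i∣≡-i D
  where
  ∣D∣≢0 : ℕ.NonZero ∣ D ∣
  ∣D∣≢0 = ℕ.≢-nonZero (D≢0 ∘ ∣i∣≡0⇒i≡0)
... | u , u∣D∣≡1 | inj₁ ∣D∣≡D  = u , subst (λ z → (u * z) ≡ 1ℤ [mod p ]) ∣D∣≡D u∣D∣≡1
... | u , u∣D∣≡1 | inj₂ ∣D∣≡-D = - u , subst (_≡ 1ℤ [mod p ]) (begin
  u * + ∣ D ∣  ≡⟨ cong (u *_) ∣D∣≡-D ⟩
  u * - D      ≡⟨ neg-distribʳ-* u D ⟨
  - (u * D)    ≡⟨ neg-distribˡ-* u D ⟩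
  - u * D      ∎) u∣D∣≡1
  where open ≡-Reasoning

I : Mat
I = mat 1ℤ 0ℤ 0ℤ 1ℤ

·-identityʳ : ∀ x → x · I ≡ x
·-identityʳ (x , y) = cong₂ _,_ (first x y) (second x y)
  where
  first : ∀ x y → x * 1ℤ + y * 0ℤ ≡ x
  first = solve-∀
  second : ∀ x y → x * 0ℤ + y * 1ℤ ≡ y
  second = solve-∀

I∈SO : ∀ A N → InSO A N I
I∈SO A N = ≡⇒≡[mod] {x = 1ℤ} refl , λ x → ≡⇒≡[mod] (cong (Q A) (·-identityʳ x))

αI+βAᵀ : Mat → ℤ → ℤ → Mat
αI+βAᵀ (mat a b c d) α β = mat (α + β * a) (β * c) (β * b) (α + β * d)

Q-·-αI+βAᵀ : ∀ A α β x → Q A (x · αI+βAᵀ A α β) ≡ det (αI+βAᵀ A α β) * Q A x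
Q-·-αI+βAᵀ (mat a b c d) α β (x , y) = identity a b c d α β x y
  where
  identity : ∀ a b c d α β x y →
    c * (x * (α + β * a) + y * (β * b)) * (x * (α + β * a) + y * (β * b))
      + (d - a) * (x * (α + β * a) + y * (β * b)) * (x * (β * c) + y * (α + β * d))
      - b * (x * (β * c) + y * (α + β * d)) * (x * (β * c) + y * (α + β * d))
    ≡ ((α + β * a) * (α + β * d) - β * c * (β * b)) * (c * x * x + (d - a) * x * y - b * y * y)
  identity = solve-∀

αI+βAᵀ∈SO : ∀ A α β {N} → det (αI+βAᵀ A α β) ≡ 1ℤ [mod N ] → InSO A N (αI+βAᵀ A α β)
αI+βAᵀ∈SO A α β det≡1 = det≡1 , λ x →
  ≡[mod]-trans (Q A (x · M)) (det M * Q A x) (Q A x)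
    (≡⇒≡[mod] (Q-·-αI+βAᵀ A α β x)) (≡1[mod]⇒*-identityˡ (det M) (Q A x) det≡1)
  where
  M = αI+βAᵀ A α β

-- α n + β (n Aᵀ) = Q A n · m solved by Cramer's rule: the rows n and n Aᵀ have determinant Q A n.
cramer-α : Mat → Vec2 → Vec2 → ℤ
cramer-α (mat a b c d) (n₁ , n₂) (m₁ , m₂) = m₁ * (n₁ * c + n₂ * d) - m₂ * (n₁ * a + n₂ * b)

cramer-β : Vec2 → Vec2 → ℤ
cramer-β (n₁ , n₂) (m₁ , m₂) = n₁ * m₂ - n₂ * m₁

transporter : Mat → ℤ → Vec2 → Vec2 → Mat
transporter A u n m = αI+βAᵀ A (u * cramer-α A n m) (u * cramer-β n m)

·-transporter : ∀ A u n m₁ m₂ → n · transporter A u n (m₁ , m₂) ≡ (u * Q A n * m₁ , u * Q A n * m₂)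
·-transporter (mat a b c d) u (n₁ , n₂) m₁ m₂ =
  cong₂ _,_ (first a b c d u n₁ n₂ m₁ m₂) (second a b c d u n₁ n₂ m₁ m₂)
  where
  first : ∀ a b c d u n₁ n₂ m₁ m₂ →
    let α = m₁ * (n₁ * c + n₂ * d) - m₂ * (n₁ * a + n₂ * b)
        β = n₁ * m₂ - n₂ * m₁
    in n₁ * (u * α + u * β * a) + n₂ * (u * β * b)
       ≡ u * (c * n₁ * n₁ + (d - a) * n₁ * n₂ - b * n₂ * n₂) * m₁
  first = solve-∀
  second : ∀ a b c d u n₁ n₂ m₁ m₂ →
    let α = m₁ * (n₁ * c + n₂ * d) - m₂ * (n₁ * a + n₂ * b)
        β = n₁ * m₂ - n₂ * m₁
    in n₁ * (u * β * c) + n₂ * (u * α + u * β * d)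
       ≡ u * (c * n₁ * n₁ + (d - a) * n₁ * n₂ - b * n₂ * n₂) * m₂
  second = solve-∀

det-transporter : ∀ A u n m → det (transporter A u n m) ≡ u * Q A n * (u * Q A m)
det-transporter (mat a b c d) u (n₁ , n₂) (m₁ , m₂) = identity a b c d u n₁ n₂ m₁ m₂
  where
  identity : ∀ a b c d u n₁ n₂ m₁ m₂ →
    let α = m₁ * (n₁ * c + n₂ * d) - m₂ * (n₁ * a + n₂ * b)
        β = n₁ * m₂ - n₂ * m₁
    in (u * α + u * β * a) * (u * α + u * β * d) - u * β * c * (u * β * b)
       ≡ u * (c * n₁ * n₁ + (d - a) * n₁ * n₂ - b * n₂ * n₂)
           * (u * (c * m₁ * m₁ + (d - a) * m₁ * m₂ - b * m₂ * m₂))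
  identity = solve-∀

transporter∈SO : ∀ A u n m {N} → Q A m ≡ Q A n → (u * Q A n) ≡ 1ℤ [mod N ] →
                 InSO A N (transporter A u n m)
transporter∈SO A u n m Qm≡Qn w≡1 = αI+βAᵀ∈SO A (u * cramer-α A n m) (u * cramer-β n m)
  (≡[mod]-trans (det B) (w * w) 1ℤ (≡⇒≡[mod] detB≡w²)
    (≡[mod]-trans (w * w) w 1ℤ (≡1[mod]⇒*-identityˡ w w w≡1) w≡1))
  where
  w = u * Q A n
  B = transporter A u n m
  detB≡w² : det B ≡ w * w
  detB≡w² = trans (det-transporter A u n m) (cong (λ q → w * (u * q)) Qm≡Qn)

transporter-maps : ∀ A u n m {N} → (u * Q A n) ≡ 1ℤ [mod N ] →
                   m ≡v n · transporter A u n m [mod N ]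
transporter-maps A u n (m₁ , m₂) {N} w≡1 =
  subst (λ v → (m₁ , m₂) ≡v v [mod N ]) (sym (·-transporter A u n m₁ m₂))
    ( ≡[mod]-sym (w * m₁) m₁ (≡1[mod]⇒*-identityˡ w m₁ w≡1)
    , ≡[mod]-sym (w * m₂) m₂ (≡1[mod]⇒*-identityˡ w m₂ w≡1))
  where
  w = u * Q A n

lemma2p1 : (A : Mat) → IsHyperbolicSL2 A →
    (m n : Vec2) → Q A m ≡ Q A n →
    ∃ λ (N₀ : ℕ) → ∀ (N : ℕ) → N ≥ N₀ → Prime N →
      Σ Mat λ B → InSO A N B × (m ≡v n · B [mod N ])
lemma2p1 A hyp m n Qm≡Qn with Q A n ≟ 0ℤ
... | yes Qn≡0 = 0 , λ N _ _ → I , I∈SO A N , ≡⇒≡v[mod] (trans m≡0 (sym (trans (·-identityʳ n) n≡0)))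
  where
  n≡0 = Q-anisotropic {A} hyp n Qn≡0
  m≡0 = Q-anisotropic {A} hyp m (trans Qm≡Qn Qn≡0)
... | no Qn≢0 = ℕ.suc ∣ Q A n ∣ , λ N ∣Qn∣<N N-prime →
  let (u , uQn≡1) = inverse-mod-prime N-prime Qn≢0 ∣Qn∣<N
  in transporter A u n m , transporter∈SO A u n m Qm≡Qn uQn≡1 , transporter-maps A u n m uQn≡1
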